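{- Let $\mathcal{L}$ be a finite trim lattice of length $n$, and let $(x_i)_{i=0}^n$ and $(x'_i)_{i=0}^n$ be two chains of maximal length in $\mathcal{L}$, with associated maps $\beta_\mathcal{J},\beta'_\mathcal{J}:\mathcal{J}\to[n]$ and labellings $\gamma,\gamma'$. Let $y\lessdot z$ be a cover relation, and let $a,b\in\mathcal{J}$ satisfy $\gamma(y\lessdot z)=\beta_\mathcal{J}(a)$ and $\gamma'(y\lessdot z)=\beta'_\mathcal{J}(b)$. Then $a=b$.
   Context: A finite lattice of length $n$ is extremal if it has exactly $n$ join-irreducible and $n$ meet-irreducible elements; an element $x$ is left modular if $(y\vee x)\wedge z=y\vee(x\wedge z)$ for all $y\le z$; the lattice is trim if it is extremal and has a maximal chain of left modular elements. $\mathcal{J}$ is the set of join-irreducible elements. For a chain $\hat0=x_0\lessdot\dots\lessdot x_n=\hat1$ of maximal length, $\beta_\mathcal{J}(j)=\min\{i: j\le x_i\}$ (a bijection $\mathcal{J}\to[n]$ in an extremal lattice), and the labelling is $\gamma(y\lessdot z)=\min\{i\in[n]: y\vee(x_i\wedge z)=z\}$; $\beta'_\mathcal{J},\gamma'$ are defined the same way from $(x'_i)$. -}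

module Defs where

open import Level using (0ℓ)
open import Data.Nat using (ℕ; zero; suc)
open import Data.Fin using (Fin; zero; suc; inject₁; fromℕ) renaming (_≤_ to _≤ᶠ_)
open import Data.Product using (Σ; ∃; _×_; _,_)
open import Data.Sum using (_⊎_)
open import Relation.Nullary using (¬_)
open import Relation.Binary using (Rel)
open import Relation.Binary.PropositionalEquality using (_≡_; _≢_)
open import Relation.Binary.Lattice.Structures using (IsLattice)
open import Algebra.Core using (Op₂)
open import Function.Bundles using (_↔_)
open import Function.Definitions using (Injective)

record FiniteLattice : Set₁ where
  field
    Carrier   : Set
    _≤_       : Rel Carrier 0ℓ
    _∨_       : Op₂ Carrier
    _∧_       : Op₂ Carrier
    isLattice : IsLattice _≡_ _≤_ _∨_ _∧_
    size      : ℕ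
    finite    : Carrier ↔ Fin size

module _ (L : FiniteLattice) where
  open FiniteLattice L

  _<_ : Rel Carrier 0ℓ
  x < y = (x ≤ y) × (x ≢ y)

  _⋖_ : Rel Carrier 0ℓ
  y ⋖ z = (y < z) × (∀ w → ¬ ((y < w) × (w < z)))

  IsBottom : Carrier → Set
  IsBottom b = ∀ y → b ≤ y

  IsTop : Carrier → Set
  IsTop t = ∀ y → y ≤ t

  JoinIrr : Carrier → Set
  JoinIrr j = (¬ IsBottom j) × (∀ a b → j ≡ a ∨ b → (j ≡ a) ⊎ (j ≡ b))

  MeetIrr : Carrier → Set
  MeetIrr m = (¬ IsTop m) × (∀ a b → m ≡ a ∧ b → (m ≡ a) ⊎ (m ≡ b))

  StrictChain : (k : ℕ) → (Fin (suc k) → Carrier) → Set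
  StrictChain k c = ∀ (i : Fin k) → c (inject₁ i) < c (suc i)

  HasLength : ℕ → Set
  HasLength n = (∃ λ (c : Fin (suc n) → Carrier) → StrictChain n c)
              × (∀ k (c : Fin (suc k) → Carrier) → StrictChain k c → k Data.Nat.≤ n)

  HasExactly : ℕ → (Carrier → Set) → Set
  HasExactly n P = ∃ λ (f : Fin n → Carrier) →
                     Injective _≡_ _≡_ f × (∀ k → P (f k)) × (∀ x → P x → ∃ λ k → f k ≡ x)

  Extremal : ℕ → Set
  Extremal n = HasLength n × HasExactly n JoinIrr × HasExactly n MeetIrr

  LeftModular : Carrier → Set
  LeftModular x = ∀ y z → y ≤ z → (y ∨ x) ∧ z ≡ y ∨ (x ∧ z)

  MaximalChain : (k : ℕ) → (Fin (suc k) → Carrier) → Set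
  MaximalChain k c = IsBottom (c zero) × IsTop (c (fromℕ k))
                   × (∀ (i : Fin k) → c (inject₁ i) ⋖ c (suc i))

  Trim : ℕ → Set
  Trim n = Extremal n × (∃ λ k → ∃ λ (c : Fin (suc k) → Carrier) →
                           MaximalChain k c × (∀ i → LeftModular (c i)))

  MaxLengthChain : (n : ℕ) → (Fin (suc n) → Carrier) → Set
  MaxLengthChain n x = StrictChain n x

  IsMin : {n : ℕ} → (Fin n → Set) → Fin n → Set
  IsMin P i = P i × (∀ k → P k → i ≤ᶠ k)

  BetaIs : (n : ℕ) → (Fin (suc n) → Carrier) → Carrier → Fin (suc n) → Set
  BetaIs n x j = IsMin (λ i → j ≤ x i)

  -- γ(y ⋖ z) = i  :⇔  i = min{ i ∈ [n] : y ∨ (x_i ∧ z) = z }   ([n] = {1,…,n})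
  GammaIs : (n : ℕ) → (Fin (suc n) → Carrier) → Carrier → Carrier → Fin (suc n) → Set
  GammaIs n x y z = IsMin (λ i → (i ≢ zero) × (y ∨ (x i ∧ z) ≡ z))

-- Along a chain x₀ < ⋯ < xₙ of maximal length in an extremal lattice, every step xᵢ < xᵢ₊₁ has
-- exactly one join-irreducible entering it (j ≤ xᵢ₊₁, j ≰ xᵢ) and exactly one meet-irreducible
-- leaving it (xᵢ ≤ m, xᵢ₊₁ ≰ m): each step has one, distinct steps have distinct ones, and there
-- are only n of each. The induced pairing j ↦ m does not depend on the chain: for two chains, the
-- map sending a step of the second to the step where the partner (in the first) of its entering
-- join-irreducible leaves is injective and never increases the index, hence is the identity.
-- A left-modular maximal chain c has length n: each step xᵢ < xᵢ₊₁ of a longest chain becomes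
-- absorbed (xᵢ₊₁ ≤ xᵢ ∨ cᵣ) across some cover of c, and left modularity makes these covers distinct.
-- For a cover y ⋖ z, a step of c across which y ∨ (cᵣ ∧ z) jumps from y to z yields a pair (j, m)
-- with j ≤ z, j ≰ y, y ≤ m, z ≰ m. On any longest chain the join-irreducible
-- entering at step γ(y ⋖ z) is then j: had j entered earlier it would lie below y, had it entered
-- later then z would lie below its partner m.

module Submission where

open import Defs
open import Level using (0ℓ)
open import Function.Base using (_∘_; flip)
open import Function.Bundles using (Inverse)
open import Function.Definitions using (Injective)
open import Data.Nat as ℕ using (ℕ; zero; suc)
import Data.Nat.Properties as ℕP
open import Data.Fin using (Fin; zero; suc; inject₁; fromℕ; toℕ; punchOut)
  renaming (_≤_ to _≤ᶠ_; _<_ to _<ᶠ_)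
import Data.Fin.Properties as FP
import Data.Fin.Induction as FinInduction
open import Data.Product using (∃; ∃₂; _×_; _,_; proj₁; proj₂)
open import Data.Sum using (_⊎_; inj₁; inj₂)
open import Data.Empty using (⊥-elim)
open import Relation.Nullary using (¬_; Dec; yes; no)
open import Relation.Nullary.Decidable using (map′; _×-dec_; ¬?; decidable-stable; via-injection)
open import Function.Properties.Inverse using (↔⇒↣)
open import Data.Vec.Functional using (_∷_)
open import Relation.Unary using (Decidable)
open import Relation.Binary.Definitions using (Tri; tri<; tri≈; tri>)
  renaming (Decidable to DecidableRel)
open import Relation.Binary.PropositionalEquality
  using (_≡_; _≢_; refl; sym; trans; cong; subst; subst₂; module ≡-Reasoning)
open import Relation.Binary.Core using (Rel)
open import Relation.Binary.Lattice using (Lattice; IsLattice)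
import Relation.Binary.Lattice.Properties.Lattice as LatticeProperties
import Relation.Binary.Lattice.Properties.JoinSemilattice as JoinSemilatticeProperties
import Relation.Binary.Construct.On as On
import Relation.Binary.Reasoning.PartialOrder as PosetReasoning
open import Induction.WellFounded using (WellFounded; WfRec; module All; module Subrelation)

∃-crossing : ∀ {k} (P : Fin (suc k) → Set) → Decidable P → ¬ P zero → P (fromℕ k) →
             ∃ λ r → ¬ P (inject₁ r) × P (suc r)
∃-crossing {zero}  P P? ¬P₀ Pₖ = ⊥-elim (¬P₀ Pₖ)
∃-crossing {suc k} P P? ¬P₀ Pₖ with P? (suc zero)
... | yes P₁ = zero , ¬P₀ , P₁
... | no ¬P₁ with ∃-crossing (P ∘ suc) (P? ∘ suc) ¬P₁ Pₖ
...   | r , crossing = suc r , crossing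

injective⇒∃-preimage : ∀ {n} (f : Fin n → Fin n) → Injective _≡_ _≡_ f →
                       ∀ k → ∃ λ i → f i ≡ k
injective⇒∃-preimage {suc n} f f-inj k with FP.any? (λ i → f i FP.≟ k)
... | yes preimage = preimage
... | no none = ⊥-elim (ℕP.<-irrefl refl (FP.injective⇒≤ {f = g} g-inj))
  where
  k≢f : ∀ i → k ≢ f i
  k≢f i k≡fi = none (i , sym k≡fi)
  -- f misses k, so punching k out of its codomain injects Fin (suc n) into Fin n
  g : Fin (suc n) → Fin n
  g i = punchOut (k≢f i)
  g-inj : Injective _≡_ _≡_ g
  g-inj {i} {i′} e = f-inj (FP.punchOut-injective (k≢f i) (k≢f i′) e)

deflationary-injection⇒id : ∀ {n} (f : Fin n → Fin n) → Injective _≡_ _≡_ f →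
                            (∀ i → f i ≤ᶠ i) → ∀ i → f i ≡ i
deflationary-injection⇒id f f-inj f≤ = All.wfRec FinInduction.<-wellFounded 0ℓ (λ i → f i ≡ i) fixed
  where
  fixed : ∀ i → WfRec _<ᶠ_ (λ i → f i ≡ i) i → f i ≡ i
  fixed i rec with f i FP.≟ i
  ... | yes fi≡i = fi≡i
  ... | no fi≢i = ⊥-elim (fi≢i (f-inj (rec (FP.≤∧≢⇒< (f≤ i) fi≢i))))

module FiniteLatticeProperties (L : FiniteLattice) where
  open FiniteLattice L
  open Inverse finite using (to; from; strictlyInverseʳ)
  open IsLattice isLattice using (isPartialOrder; x≤x∨y; y≤x∨y; ∨-least)
    renaming (refl to ≤-refl; trans to ≤-trans)

  infix 4 _<ₗ_ _≟_ _≤?_ _<?_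
  _<ₗ_ : Rel Carrier 0ℓ
  _<ₗ_ = _<_ L

  lattice : Lattice 0ℓ 0ℓ 0ℓ
  lattice = record { isLattice = isLattice }

  _≟_ : DecidableRel (_≡_ {A = Carrier})
  _≟_ = via-injection (↔⇒↣ finite) FP._≟_

  _≤?_ : DecidableRel _≤_
  _≤?_ = ≈-dec⇒≤-dec _≟_
    where open JoinSemilatticeProperties (Lattice.joinSemilattice lattice)

  _<?_ : DecidableRel _<ₗ_
  a <? b = (a ≤? b) ×-dec ¬? (a ≟ b)

  any? : {Q : Carrier → Set} → Decidable Q → Dec (∃ Q)
  any? {Q} Q? = map′ (λ (k , q) → from k , q)
                     (λ (w , q) → to w , subst Q (sym (strictlyInverseʳ w)) q)
                     (FP.any? (Q? ∘ from))

  <-wellFounded : WellFounded _<ₗ_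
  <-wellFounded = Subrelation.wellFounded through-encoding
    (On.wellFounded to (FinInduction.po-wellFounded (On.isPartialOrder from isPartialOrder)))
    where
    through-encoding : ∀ {a b} → a <ₗ b → from (to a) <ₗ from (to b)
    through-encoding {a} {b} = subst₂ _<ₗ_ (sym (strictlyInverseʳ a)) (sym (strictlyInverseʳ b))

  minimal⇒joinIrr : ∀ {u v} → ¬ u ≤ v → (∀ w → w <ₗ u → w ≤ v) → JoinIrr L u
  minimal⇒joinIrr {u} {v} u≰v below = (λ u-bottom → u≰v (u-bottom v)) , irreducible
    where
    irreducible : ∀ a b → u ≡ a ∨ b → u ≡ a ⊎ u ≡ b
    irreducible a b u≡a∨b with u ≟ a | u ≟ b
    ... | yes u≡a | _       = inj₁ u≡a
    ... | no _    | yes u≡b = inj₂ u≡b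
    ... | no u≢a  | no u≢b  = ⊥-elim (u≰v (subst (_≤ v) (sym u≡a∨b)
          (∨-least (below a (a≤u , u≢a ∘ sym)) (below b (b≤u , u≢b ∘ sym)))))
      where
      a≤u : a ≤ u
      a≤u = subst (a ≤_) (sym u≡a∨b) (x≤x∨y a b)
      b≤u : b ≤ u
      b≤u = subst (b ≤_) (sym u≡a∨b) (y≤x∨y a b)

  joinIrr-below : ∀ {u v} → ¬ u ≤ v → ∃ λ j → JoinIrr L j × j ≤ u × ¬ j ≤ v
  joinIrr-below {u} {v} = All.wfRec <-wellFounded 0ℓ Goal step u
    where
    Goal : Carrier → Set
    Goal u = ¬ u ≤ v → ∃ λ j → JoinIrr L j × j ≤ u × ¬ j ≤ v
    step : ∀ u → WfRec _<ₗ_ Goal u → Goal u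
    step u rec u≰v with any? (λ w → (w <? u) ×-dec ¬? (w ≤? v))
    ... | yes (w , w<u , w≰v) with rec w<u w≰v
    ...   | j , j-irr , j≤w , j≰v = j , j-irr , ≤-trans j≤w (proj₁ w<u) , j≰v
    step u rec u≰v | no none = u , minimal⇒joinIrr u≰v below , ≤-refl , u≰v
      where
      below : ∀ w → w <ₗ u → w ≤ v
      below w w<u = decidable-stable (w ≤? v) (λ w≰v → none (w , w<u , w≰v))

dual : FiniteLattice → FiniteLattice
dual L = record
  { Carrier = Carrier ; _≤_ = flip _≤_ ; _∨_ = _∧_ ; _∧_ = _∨_
  ; isLattice = ∧-∨-isLattice ; size = size ; finite = finite }
  where
  open FiniteLattice L
  open LatticeProperties (FiniteLatticeProperties.lattice L) using (∧-∨-isLattice)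

-- MeetIrr L and JoinIrr (dual L) coincide definitionally.
meetIrr-above : ∀ L {u v} → ¬ FiniteLattice._≤_ L u v →
                ∃ λ m → MeetIrr L m × FiniteLattice._≤_ L v m × ¬ FiniteLattice._≤_ L u m
meetIrr-above L = FiniteLatticeProperties.joinIrr-below (dual L)

module ChainProperties (L : FiniteLattice) where
  open FiniteLattice L
  open FiniteLatticeProperties L using (_≤?_; joinIrr-below)
  open IsLattice isLattice using (x∧y≤x; x∧y≤y)
    renaming (refl to ≤-refl; trans to ≤-trans; antisym to ≤-antisym)

  chain-mono : ∀ {n} (x : Fin (suc n) → Carrier) → StrictChain L n x → ∀ {p q} → p ≤ᶠ q → x p ≤ x q
  chain-mono x ch {zero} {zero} _ = ≤-refl
  chain-mono {suc n} x ch {zero} {suc q} _ =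
    ≤-trans (proj₁ (ch zero)) (chain-mono (x ∘ suc) (ch ∘ suc) {zero} {q} ℕ.z≤n)
  chain-mono {suc n} x ch {suc p} {suc q} (ℕ.s≤s p≤q) = chain-mono (x ∘ suc) (ch ∘ suc) p≤q

  later-step : ∀ {n} (x : Fin (suc n) → Carrier) → StrictChain L n x →
               ∀ {i k} → i <ᶠ k → x (suc i) ≤ x (inject₁ k)
  later-step x ch {i} {k} i<k = chain-mono x ch (subst (suc (toℕ i) ℕ.≤_) (sym (FP.toℕ-inject₁ k)) i<k)

  maxLength-bottom : ∀ {n} (x : Fin (suc n) → Carrier) → HasLength L n → StrictChain L n x →
                     IsBottom L (x zero)
  maxLength-bottom {n} x (_ , bounded) ch w =
    decidable-stable (x zero ≤? w)
      (λ x₀≰w → ℕP.<-irrefl refl (bounded (suc n) (w ∧ x zero ∷ x) (longer x₀≰w)))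
    where
    longer : ¬ x zero ≤ w → StrictChain L (suc n) (w ∧ x zero ∷ x)
    longer x₀≰w zero    = x∧y≤y w (x zero) ,
                          λ w∧x₀≡x₀ → x₀≰w (subst (_≤ w) w∧x₀≡x₀ (x∧y≤x w (x zero)))
    longer x₀≰w (suc i) = ch i

  maximalChain⇒strict : ∀ {k} (c : Fin (suc k) → Carrier) → MaximalChain L k c → StrictChain L k c
  maximalChain⇒strict _ (_ , _ , covers) r = proj₁ (covers r)

  -- Enters x i j holds exactly when β_J(j) = i + 1 for the chain x.
  Enters : ∀ {n} → (Fin (suc n) → Carrier) → Fin n → Carrier → Set
  Enters x i j = j ≤ x (suc i) × ¬ j ≤ x (inject₁ i)

  Leaves : ∀ {n} → (Fin (suc n) → Carrier) → Fin n → Carrier → Set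
  Leaves x i m = x (inject₁ i) ≤ m × ¬ x (suc i) ≤ m

  module OnChain {n} (x : Fin (suc n) → Carrier) (ch : StrictChain L n x) where

    step-not-below : ∀ i → ¬ x (suc i) ≤ x (inject₁ i)
    step-not-below i le = proj₂ (ch i) (≤-antisym (proj₁ (ch i)) le)

    enters-≤ : ∀ {i q j} → j ≤ x (suc i) → Enters x q j → q ≤ᶠ i
    enters-≤ {i} {q} j≤xᵢ₊₁ (_ , j≰x_q) = decidable-stable (q FP.≤? i)
      (λ q≰i → j≰x_q (≤-trans j≤xᵢ₊₁ (later-step x ch (ℕP.≰⇒> q≰i))))

    leaves-≥ : ∀ {i q m} → x (inject₁ i) ≤ m → Leaves x q m → i ≤ᶠ q
    leaves-≥ {i} {q} xᵢ≤m (_ , x_q₊₁≰m) = decidable-stable (i FP.≤? q)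
      (λ i≰q → x_q₊₁≰m (≤-trans (later-step x ch (ℕP.≰⇒> i≰q)) xᵢ≤m))

    enters-step-unique : ∀ {i k j} → Enters x i j → Enters x k j → i ≡ k
    enters-step-unique eᵢ eₖ = FP.≤-antisym (enters-≤ (proj₁ eₖ) eᵢ) (enters-≤ (proj₁ eᵢ) eₖ)

    leaves-step-unique : ∀ {i k m} → Leaves x i m → Leaves x k m → i ≡ k
    leaves-step-unique lᵢ lₖ = FP.≤-antisym (leaves-≥ (proj₁ lᵢ) lₖ) (leaves-≥ (proj₁ lₖ) lᵢ)

    enters-before-leaves : ∀ {i k j m} → i <ᶠ k → Enters x i j → Leaves x k m → j ≤ m
    enters-before-leaves i<k (j≤xᵢ₊₁ , _) (xₖ≤m , _) =
      ≤-trans j≤xᵢ₊₁ (≤-trans (later-step x ch i<k) xₖ≤m)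

    ∃-entering : ∀ i → ∃ λ j → JoinIrr L j × Enters x i j
    ∃-entering i = joinIrr-below (step-not-below i)

    ∃-leaving : ∀ i → ∃ λ m → MeetIrr L m × Leaves x i m
    ∃-leaving i = meetIrr-above L (step-not-below i)

    enters-leaves-order : ∀ {i k j m} → Enters x i j → Leaves x k m → ¬ j ≤ m → k ≤ᶠ i
    enters-leaves-order {i} {k} eᵢ lₖ j≰m = decidable-stable (k FP.≤? i)
      (λ k≰i → j≰m (enters-before-leaves (ℕP.≰⇒> k≰i) eᵢ lₖ))

  injection-into-exactly⇒∃-preimage : ∀ {n} {P : Carrier → Set} → HasExactly L n P →
    (t : Fin n → Carrier) → Injective _≡_ _≡_ t → (∀ i → P (t i)) → ∀ {a} → P a → ∃ λ i → t i ≡ a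
  injection-into-exactly⇒∃-preimage {n} (f , _ , _ , f-onto) t t-inj t-P {a} Pa =
    let (k , fk≡a) = f-onto a Pa
        (i , index-i≡k) = injective⇒∃-preimage index index-inj k
    in i , (begin
      t i          ≡⟨ sym (f-index i) ⟩
      f (index i)  ≡⟨ cong f index-i≡k ⟩
      f k          ≡⟨ fk≡a ⟩
      a            ∎)
    where
    open ≡-Reasoning
    index : Fin n → Fin n
    index i = proj₁ (f-onto (t i) (t-P i))
    f-index : ∀ i → f (index i) ≡ t i
    f-index i = proj₂ (f-onto (t i) (t-P i))
    index-inj : Injective _≡_ _≡_ index
    index-inj {i} {i′} e = t-inj (trans (sym (f-index i)) (trans (cong f e) (f-index i′)))

  module StepLabelling {n} {P : Carrier → Set} (exact : HasExactly L n P)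
         {Q : Fin n → Carrier → Set} (∃-label : ∀ i → ∃ λ a → P a × Q i a)
         (step-unique : ∀ {i k a} → Q i a → Q k a → i ≡ k) where

    label : Fin n → Carrier
    label i = proj₁ (∃-label i)

    label-P : ∀ i → P (label i)
    label-P i = proj₁ (proj₂ (∃-label i))

    label-Q : ∀ i → Q i (label i)
    label-Q i = proj₂ (proj₂ (∃-label i))

    label-injective : Injective _≡_ _≡_ label
    label-injective {i} {k} e = step-unique (label-Q i) (subst (Q k) (sym e) (label-Q k))

    step : ∀ {a} → P a → Fin n
    step Pa = proj₁ (injection-into-exactly⇒∃-preimage exact label label-injective label-P Pa)

    label-step : ∀ {a} (Pa : P a) → label (step Pa) ≡ a
    label-step Pa = proj₂ (injection-into-exactly⇒∃-preimage exact label label-injective label-P Pa)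

    step-Q : ∀ {a} (Pa : P a) → Q (step Pa) a
    step-Q Pa = subst (Q (step Pa)) (label-step Pa) (label-Q (step Pa))

    label-unique : ∀ {i a} → P a → Q i a → label i ≡ a
    label-unique {i} {a} Pa Qa = subst (λ k → label k ≡ a) (step-unique (step-Q Pa) Qa) (label-step Pa)

  module ChainLabels {n} (ext : Extremal L n) (x : Fin (suc n) → Carrier) (ch : StrictChain L n x) where
    open OnChain x ch public
    open StepLabelling (proj₁ (proj₂ ext)) ∃-entering enters-step-unique public
      renaming ( label to entering; label-P to entering-joinIrr; label-Q to entering-enters
               ; label-injective to entering-injective; label-step to entering-entry
               ; step to entry; step-Q to enters-entry; label-unique to entering-unique )
    open StepLabelling (proj₂ (proj₂ ext)) ∃-leaving leaves-step-unique public
      renaming ( label to leaving; label-P to leaving-meetIrr; label-Q to leaving-leaves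
               ; label-injective to leaving-injective; label-step to leaving-exit
               ; step to exit; step-Q to leaves-exit; label-unique to leaving-unique )

    enters-leaves-not-below : ∀ {i j m} → JoinIrr L j → Enters x i j → Leaves x i m → ¬ j ≤ m
    enters-leaves-not-below {i} {j} {m} j-irr eᵢ lᵢ@(_ , xᵢ₊₁≰m) j≤m with joinIrr-below xᵢ₊₁≰m
    ... | j′ , j′-irr , j′≤xᵢ₊₁ , j′≰m = j′≰m (below-m (entry j′-irr) (enters-entry j′-irr))
      where
      below-m : ∀ q → Enters x q j′ → j′ ≤ m
      below-m q e with q FP.≟ i
      ... | yes refl =
        subst (_≤ m) (trans (sym (entering-unique j-irr eᵢ)) (entering-unique j′-irr e)) j≤m
      ... | no q≢i = enters-before-leaves (FP.≤∧≢⇒< (enters-≤ j′≤xᵢ₊₁ e) q≢i) e lᵢ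

  module Transfer {n} (ext : Extremal L n) (c x : Fin (suc n) → Carrier)
         (ch-c : StrictChain L n c) (ch-x : StrictChain L n x) where
    module C = ChainLabels ext c ch-c
    module X = ChainLabels ext x ch-x

    entry-in-c : Fin n → Fin n
    entry-in-c i = C.entry (X.entering-joinIrr i)

    σ : Fin n → Fin n
    σ i = X.exit (C.leaving-meetIrr (entry-in-c i))

    σ-deflationary : ∀ i → σ i ≤ᶠ i
    σ-deflationary i = X.enters-leaves-order (X.entering-enters i) (X.leaves-exit _)
      (C.enters-leaves-not-below (X.entering-joinIrr i) (C.enters-entry _)
        (C.leaving-leaves (entry-in-c i)))

    σ-injective : Injective _≡_ _≡_ σ
    σ-injective {i} {i′} σi≡σi′ = X.entering-injective (begin
      X.entering i                ≡⟨ sym (C.entering-entry _) ⟩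
      C.entering (entry-in-c i)   ≡⟨ cong C.entering (C.leaving-injective (begin
        C.leaving (entry-in-c i)    ≡⟨ sym (X.leaving-exit _) ⟩
        X.leaving (σ i)             ≡⟨ cong X.leaving σi≡σi′ ⟩
        X.leaving (σ i′)            ≡⟨ X.leaving-exit _ ⟩
        C.leaving (entry-in-c i′)   ∎)) ⟩
      C.entering (entry-in-c i′)  ≡⟨ C.entering-entry _ ⟩
      X.entering i′               ∎)
      where open ≡-Reasoning

    partner-leaves : ∀ i → Leaves x i (C.leaving (entry-in-c i))
    partner-leaves i = subst (λ k → Leaves x k (C.leaving (entry-in-c i)))
      (deflationary-injection⇒id σ σ-injective σ-deflationary i) (X.leaves-exit _)

  Paired : ℕ → Carrier → Carrier → Set
  Paired n j m = ∃₂ λ (c : Fin (suc n) → Carrier) (p : Fin n) →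
                   StrictChain L n c × Enters c p j × Leaves c p m

  paired-leaves : ∀ {n j m} → Extremal L n → JoinIrr L j → MeetIrr L m → Paired n j m →
                  ∀ x → StrictChain L n x → ∀ {q} → Enters x q j → Leaves x q m
  paired-leaves {m = m} ext j-irr m-irr (c , p , ch-c , e-c , l-c) x ch-x {q} e-x =
    subst (Leaves x q) (trans (cong C.leaving entry≡p) (C.leaving-unique m-irr l-c)) (partner-leaves q)
    where
    open Transfer ext c x ch-c ch-x
    entry≡p : entry-in-c q ≡ p
    entry≡p = C.enters-step-unique (C.enters-entry _)
      (subst (Enters c p) (sym (X.entering-unique j-irr e-x)) e-c)

module TrimProperties (L : FiniteLattice) where
  open FiniteLattice L
  open FiniteLatticeProperties L using (lattice; _≟_; _≤?_; joinIrr-below)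
  open ChainProperties L
  open IsLattice isLattice using (x≤x∨y; y≤x∨y; ∨-least; x∧y≤x; x∧y≤y; ∧-greatest)
    renaming (refl to ≤-refl; trans to ≤-trans; antisym to ≤-antisym)
  open PosetReasoning (Lattice.poset lattice)

  infix 4 _⋖ₗ_
  _⋖ₗ_ : Carrier → Carrier → Set
  _⋖ₗ_ = _⋖_ L

  ∨-absorbs-below : ∀ {u v} → u ≤ v → v ∨ u ≡ v
  ∨-absorbs-below {u} {v} u≤v = ≤-antisym (∨-least ≤-refl u≤v) (x≤x∨y v u)

  ⋖-between : ∀ {y z w} → y ⋖ₗ z → y ≤ w → w ≤ z → w ≡ y ⊎ w ≡ z
  ⋖-between {y} {z} {w} (_ , nothing-between) y≤w w≤z with w ≟ y | w ≟ z
  ... | yes w≡y | _       = inj₁ w≡y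
  ... | no _    | yes w≡z = inj₂ w≡z
  ... | no w≢y  | no w≢z  = ⊥-elim (nothing-between w ((y≤w , w≢y ∘ sym) , (w≤z , w≢z)))

  ⋖-below : ∀ {y z u} → y ⋖ₗ z → u ≤ z → y ∨ u ≢ z → u ≤ y
  ⋖-below {y} {z} {u} y⋖z@((y≤z , _) , _) u≤z y∨u≢z
    with ⋖-between y⋖z (x≤x∨y y u) (∨-least y≤z u≤z)
  ... | inj₁ y∨u≡y = subst (u ≤_) y∨u≡y (y≤x∨y y u)
  ... | inj₂ y∨u≡z = ⊥-elim (y∨u≢z y∨u≡z)

  ⋖-generated : ∀ {a b u v} → a ⋖ₗ b → u ≤ b → ¬ u ≤ a → u ≤ v → b ≤ (v ∨ a)
  ⋖-generated {a} {b} {u} {v} a⋖b@((a≤b , _) , _) u≤b u≰a u≤v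
    with ⋖-between a⋖b (∧-greatest (y≤x∨y v a) a≤b) (x∧y≤y (v ∨ a) b)
  ... | inj₁ w≡a = ⊥-elim (u≰a (subst (u ≤_) w≡a (∧-greatest (≤-trans u≤v (x≤x∨y v a)) u≤b)))
  ... | inj₂ w≡b = subst (_≤ (v ∨ a)) w≡b (x∧y≤x (v ∨ a) b)

  -- Left modularity of b gives B = A ∨ (b ∧ B), so b ∧ B lies below b but not below a.
  crossing-absorbs : ∀ {a b A B C} → a ⋖ₗ b → LeftModular L b → A ≤ B →
                     ¬ B ≤ (A ∨ a) → B ≤ (A ∨ b) → B ≤ C → b ≤ (C ∨ a)
  crossing-absorbs {a} {b} {A} {B} {C} a⋖b b-lm A≤B B≰A∨a B≤A∨b B≤C =
    ⋖-generated a⋖b (x∧y≤x b B) b∧B≰a (≤-trans (x∧y≤y b B) B≤C)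
    where
    B≡A∨b∧B : B ≡ A ∨ (b ∧ B)
    B≡A∨b∧B = trans (sym (≤-antisym (x∧y≤y (A ∨ b) B) (∧-greatest B≤A∨b ≤-refl))) (b-lm A B A≤B)
    b∧B≰a : ¬ (b ∧ B) ≤ a
    b∧B≰a b∧B≤a = B≰A∨a (subst (_≤ (A ∨ a)) (sym B≡A∨b∧B)
      (∨-least (x≤x∨y A a) (≤-trans b∧B≤a (y≤x∨y A a))))

  leftModular-maximalChain-length : ∀ {n k} (x : Fin (suc n) → Carrier) (c : Fin (suc k) → Carrier) →
    StrictChain L n x → MaximalChain L k c → (∀ r → LeftModular L (c r)) → n ℕ.≤ k
  leftModular-maximalChain-length {n} {k} x c ch (c₀-bottom , cₖ-top , c-covers) c-lm =
    FP.injective⇒≤ {f = crossing} crossing-injective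
    where
    open OnChain x ch using (step-not-below)
    Absorbed : Fin n → Fin (suc k) → Set
    Absorbed i r = x (suc i) ≤ (x (inject₁ i) ∨ c r)
    ∃-crossing-of : ∀ i → ∃ λ r → ¬ Absorbed i (inject₁ r) × Absorbed i (suc r)
    ∃-crossing-of i = ∃-crossing (Absorbed i) (λ r → x (suc i) ≤? (x (inject₁ i) ∨ c r))
      (λ absorbed → step-not-below i (subst (x (suc i) ≤_) (∨-absorbs-below (c₀-bottom _)) absorbed))
      (≤-trans (cₖ-top _) (y≤x∨y _ _))
    crossing : Fin n → Fin k
    crossing i = proj₁ (∃-crossing-of i)
    crossings-differ : ∀ {i i′} → i <ᶠ i′ → crossing i ≢ crossing i′
    crossings-differ {i} {i′} i<i′ r≡r′ = proj₁ (proj₂ (∃-crossing-of i′)) (begin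
      x (suc i′)                       ≤⟨ absorbed-at-r ⟩
      x (inject₁ i′) ∨ c (suc r)       ≤⟨ ∨-least (x≤x∨y _ _) c-step-absorbed ⟩
      x (inject₁ i′) ∨ c (inject₁ r)   ≡⟨ cong (λ r → x (inject₁ i′) ∨ c (inject₁ r)) r≡r′ ⟩
      x (inject₁ i′) ∨ c (inject₁ r′)  ∎)
      where
      r r′ : Fin k
      r = crossing i
      r′ = crossing i′
      absorbed-at-r : Absorbed i′ (suc r)
      absorbed-at-r = subst (Absorbed i′ ∘ suc) (sym r≡r′) (proj₂ (proj₂ (∃-crossing-of i′)))
      c-step-absorbed : c (suc r) ≤ (x (inject₁ i′) ∨ c (inject₁ r))
      c-step-absorbed = crossing-absorbs (c-covers r) (c-lm (suc r)) (proj₁ (ch i))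
        (proj₁ (proj₂ (∃-crossing-of i))) (proj₂ (proj₂ (∃-crossing-of i))) (later-step x ch i<i′)
    crossing-injective : Injective _≡_ _≡_ crossing
    crossing-injective {i} {i′} r≡r′ with FP.<-cmp i i′
    ... | tri< i<i′ _ _ = ⊥-elim (crossings-differ i<i′ r≡r′)
    ... | tri≈ _ i≡i′ _ = i≡i′
    ... | tri> _ _ i′<i = ⊥-elim (crossings-differ i′<i (sym r≡r′))

  record SeparatingPair (n : ℕ) (y z : Carrier) : Set where
    field
      {j m}     : Carrier
      j-joinIrr : JoinIrr L j
      m-meetIrr : MeetIrr L m
      paired    : Paired n j m
      j≤z       : j ≤ z
      j≰y       : ¬ j ≤ y
      y≤m       : y ≤ m
      z≰m       : ¬ z ≤ m

  leftModular-crossing : ∀ {n y z} (c : Fin (suc n) → Carrier) → MaximalChain L n c →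
    (∀ r → LeftModular L (c r)) → y ⋖ₗ z →
    ∃ λ p → (c (inject₁ p) ∧ z) ≤ y × ¬ (c (suc p) ∧ z) ≤ (y ∨ c (inject₁ p))
  leftModular-crossing {n} {y} {z} c (c₀-bottom , cₙ-top , _) c-lm y⋖z@((y≤z , y≢z) , _) =
    p , cₚ∧z≤y , cₚ₊₁∧z≰y∨cₚ
    where
    Reaches : Fin (suc n) → Set
    Reaches r = y ∨ (c r ∧ z) ≡ z
    crossing : ∃ λ p → ¬ Reaches (inject₁ p) × Reaches (suc p)
    crossing = ∃-crossing Reaches (λ r → y ∨ (c r ∧ z) ≟ z)
      (λ reaches → y≢z (trans (sym (∨-absorbs-below (≤-trans (x∧y≤x _ _) (c₀-bottom y)))) reaches))
      (trans (cong (y ∨_) (≤-antisym (x∧y≤y _ _) (∧-greatest (cₙ-top z) ≤-refl)))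
             (≤-antisym (∨-least y≤z ≤-refl) (y≤x∨y y z)))
    p : Fin n
    p = proj₁ crossing
    cₚ∧z≤y : (c (inject₁ p) ∧ z) ≤ y
    cₚ∧z≤y = ⋖-below y⋖z (x∧y≤y _ _) (proj₁ (proj₂ crossing))
    cₚ₊₁∧z≰y∨cₚ : ¬ (c (suc p) ∧ z) ≤ (y ∨ c (inject₁ p))
    cₚ₊₁∧z≰y∨cₚ below = y≢z (trans (sym (∨-absorbs-below (begin
      c (suc p) ∧ z                ≤⟨ ∧-greatest below (x∧y≤y _ _) ⟩
      (y ∨ c (inject₁ p)) ∧ z      ≡⟨ c-lm (inject₁ p) y z y≤z ⟩
      y ∨ (c (inject₁ p) ∧ z)      ≡⟨ ∨-absorbs-below cₚ∧z≤y ⟩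
      y                            ∎))) (proj₂ (proj₂ crossing)))

  leftModular⇒separatingPair : ∀ {n y z} (c : Fin (suc n) → Carrier) → MaximalChain L n c →
    (∀ r → LeftModular L (c r)) → y ⋖ₗ z → SeparatingPair n y z
  leftModular⇒separatingPair {n} {y} {z} c c-max c-lm y⋖z with leftModular-crossing c c-max c-lm y⋖z
  ... | p , cₚ∧z≤y , u≰y∨cₚ with joinIrr-below u≰y | meetIrr-above L u≰y∨cₚ
    where
    u≰y : ¬ (c (suc p) ∧ z) ≤ y
    u≰y u≤y = u≰y∨cₚ (≤-trans u≤y (x≤x∨y _ _))
  ... | j , j-irr , j≤u , j≰y | m , m-irr , y∨cₚ≤m , u≰m = record
    { j-joinIrr = j-irr
    ; m-meetIrr = m-irr
    ; paired    = c , p , maximalChain⇒strict c c-max , enters , leaves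
    ; j≤z       = ≤-trans j≤u (x∧y≤y _ _)
    ; j≰y       = j≰y
    ; y≤m       = ≤-trans (x≤x∨y _ _) y∨cₚ≤m
    ; z≰m       = λ z≤m → u≰m (≤-trans (x∧y≤y _ _) z≤m)
    }
    where
    enters : Enters c p j
    enters = ≤-trans j≤u (x∧y≤x _ _) ,
             λ j≤cₚ → j≰y (≤-trans (∧-greatest j≤cₚ (≤-trans j≤u (x∧y≤y _ _))) cₚ∧z≤y)
    leaves : Leaves c p m
    leaves = ≤-trans (y≤x∨y _ _) y∨cₚ≤m , λ cₚ₊₁≤m → u≰m (≤-trans (x∧y≤x _ _) cₚ₊₁≤m)

  trim⇒separatingPair : ∀ {n y z} → Trim L n → y ⋖ₗ z → SeparatingPair n y z
  trim⇒separatingPair ((((x , x-chain) , bounded) , _) , k , c , c-max , c-lm) y⋖z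
    with ℕP.≤-antisym (bounded k c (maximalChain⇒strict c c-max))
                      (leftModular-maximalChain-length x c x-chain c-max c-lm)
  ... | refl = leftModular⇒separatingPair c c-max c-lm y⋖z

  suc≰inject₁ : ∀ {n} (g : Fin n) → ¬ suc g ≤ᶠ inject₁ g
  suc≰inject₁ g = ℕP.<⇒≱ (FP.≤̄⇒inject₁< FP.≤-refl)

  γ-below : ∀ {n y z g} (x : Fin (suc n) → Carrier) → HasLength L n → StrictChain L n x → y ⋖ₗ z →
            GammaIs L n x y z (suc g) → (x (inject₁ g) ∧ z) ≤ y
  γ-below {y = y} {g = zero} x hl ch _ _ = ≤-trans (x∧y≤x _ _) (maxLength-bottom x hl ch y)
  γ-below {y = y} {z} {suc g} x _ _ y⋖z (_ , γ-min) with y ∨ (x (inject₁ (suc g)) ∧ z) ≟ z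
  ... | yes reaches = ⊥-elim (suc≰inject₁ (suc g) (γ-min _ ((λ ()) , reaches)))
  ... | no misses   = ⋖-below y⋖z (x∧y≤y _ _) misses

  β-enters : ∀ {n a g} (x : Fin (suc n) → Carrier) → BetaIs L n x a (suc g) → Enters x g a
  β-enters {g = g} x (a≤x , β-min) = a≤x , λ a≤xg → suc≰inject₁ g (β-min _ a≤xg)

  separatingPair-is-label : ∀ {n y z a i} → Extremal L n → y ⋖ₗ z → (sep : SeparatingPair n y z) →
    ∀ x → StrictChain L n x → JoinIrr L a → GammaIs L n x y z i → BetaIs L n x a i →
    a ≡ SeparatingPair.j sep
  separatingPair-is-label {i = zero} _ _ _ _ _ _ ((0≢0 , _) , _) _ = ⊥-elim (0≢0 refl)
  separatingPair-is-label {n} {y} {z} {a} {suc g} ext y⋖z sep x ch a-irr γ@((_ , reaches) , _) β =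
    compare (FP.<-cmp q g)
    where
    open SeparatingPair sep
    open ChainLabels ext x ch
    q : Fin n
    q = entry j-joinIrr
    j-enters : Enters x q j
    j-enters = enters-entry j-joinIrr
    m-leaves : Leaves x q m
    m-leaves = paired-leaves ext j-joinIrr m-meetIrr paired x ch j-enters
    compare : Tri (q <ᶠ g) (q ≡ g) (g <ᶠ q) → a ≡ j
    compare (tri< q<g _ _) = ⊥-elim (j≰y (begin
      j                   ≤⟨ ∧-greatest (≤-trans (proj₁ j-enters) (later-step x ch q<g)) j≤z ⟩
      x (inject₁ g) ∧ z   ≤⟨ γ-below x (proj₁ ext) ch y⋖z γ ⟩
      y                   ∎))
    compare (tri≈ _ q≡g _) = trans (sym (entering-unique a-irr (β-enters x β)))
      (entering-unique j-joinIrr (subst (λ k → Enters x k j) q≡g j-enters))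
    compare (tri> _ _ g<q) = ⊥-elim (z≰m (subst (_≤ m) reaches (∨-least y≤m (begin
      x (suc g) ∧ z       ≤⟨ x∧y≤x _ _ ⟩
      x (suc g)           ≤⟨ later-step x ch g<q ⟩
      x (inject₁ q)       ≤⟨ proj₁ m-leaves ⟩
      m                   ∎))))

proposition3p8 : (L : FiniteLattice) (n : ℕ) → Trim L n →
    (x x′ : Fin (suc n) → FiniteLattice.Carrier L) →
    MaxLengthChain L n x → MaxLengthChain L n x′ →
    (y z : FiniteLattice.Carrier L) → _⋖_ L y z →
    (a b : FiniteLattice.Carrier L) → JoinIrr L a → JoinIrr L b →
    (i : Fin (suc n)) → GammaIs L n x y z i → BetaIs L n x a i →
    (i′ : Fin (suc n)) → GammaIs L n x′ y z i′ → BetaIs L n x′ b i′ →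
    a ≡ b
proposition3p8 L n trim x x′ x-chain x′-chain y z y⋖z a b a-irr b-irr i γ β i′ γ′ β′ =
  trans (separatingPair-is-label ext y⋖z pair x x-chain a-irr γ β)
        (sym (separatingPair-is-label ext y⋖z pair x′ x′-chain b-irr γ′ β′))
  where
  open TrimProperties L
  ext : Extremal L n
  ext = proj₁ trim
  pair : SeparatingPair n y z
  pair = trim⇒separatingPair trim y⋖z
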